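{- Let $\Sigma$ be a finite alphabet with $q>1$ letters. For integers $\ell$, $m\geq 1$ and a word $w\in\Sigma^m$, let $\Sigma_w(\ell)$ be the number of words of length $\ell$ over $\Sigma$ that do not contain $w$ as a factor, and let $\mu(\ell,m)=\max\{\Sigma_w(\ell)\mid w\in\Sigma^m\}$. Then there is a constant $c\in\mathbb{R}^+$ such that \[\sum_{m=1}^{\lceil n/2\rceil}q^m\mu(n-2m,m)\leq c\ln n\,\frac{q^n}{\sqrt{n}}\quad\text{for all integers } n>1.\]
   Context: $\Sigma^m$ denotes the set of words of length $m$ over $\Sigma$; a factor is a contiguous subword; $\mathbb{R}^+$ is the set of positive reals. For $\ell<0$ there are no words of length $\ell$, so $\Sigma_w(\ell)=0$ and $\mu(\ell,m)=0$. -}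

module Defs where

open import Data.Nat using (ℕ; zero; suc; _+_; _*_; _∸_; _^_; _⊔_; _<_; _≤?_; _/_)
open import Data.Fin using (Fin)
open import Data.Fin.Properties using (_≟_)
open import Data.List using (List; []; _∷_; map; concatMap; length; filter; foldr)
open import Data.List.Relation.Binary.Infix.Heterogeneous using (Infix)
open import Data.List.Relation.Binary.Infix.Heterogeneous.Properties using (infix?)
open import Relation.Binary.PropositionalEquality using (_≡_)
open import Relation.Nullary using (¬?; yes; no)
open import Data.List using () renaming (allFin to allFinL)

Word : ℕ → Set
Word q = List (Fin q)

allWords : (q ℓ : ℕ) → List (Word q)
allWords q zero    = [] ∷ []
allWords q (suc ℓ) = concatMap (λ a → map (a ∷_) (allWords q ℓ)) (allFinL q)

IsFactor : {q : ℕ} → Word q → Word q → Set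
IsFactor w u = Infix _≡_ w u

avoidCount : (q : ℕ) → Word q → ℕ → ℕ
avoidCount q w ℓ = length (filter (λ u → ¬? (infix? _≟_ w u)) (allWords q ℓ))

-- μ(ℓ,m) = max { Σ_w(ℓ) | w ∈ Σ^m }  (Σ^m is nonempty when q ≥ 1).
μ : (q ℓ m : ℕ) → ℕ
μ q ℓ m = foldr _⊔_ 0 (map (λ w → avoidCount q w ℓ) (allWords q m))

-- The term q^m μ(n-2m, m), with μ(ℓ,m) = 0 for ℓ < 0 (i.e. 2m > n).
term : (q n m : ℕ) → ℕ
term q n m with 2 * m ≤? n
... | yes _ = q ^ m * μ q (n ∸ 2 * m) m
... | no  _ = 0

sumFrom1 : ℕ → (ℕ → ℕ) → ℕ
sumFrom1 zero    f = 0
sumFrom1 (suc k) f = sumFrom1 k f + f (suc k)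

-- LHS(n) = Σ_{m=1}^{⌈n/2⌉} q^m μ(n-2m, m), with ⌈n/2⌉ = (n+1)/2.
lhs : (q n : ℕ) → ℕ
lhs q n = sumFrom1 ((n + 1) / 2) (term q n)

{-# OPTIONS --safe #-}
module Submission where

-- Cut a word of length k m + r into k blocks of length m and a tail of length r. A word
-- avoiding w avoids it in every block, and w itself is one of the q^m possible blocks, so
-- μ(k m + r, m) ≤ (Q − 1)^k q^r with Q = q^m; together with k (Q − 1)^k ≤ Q^(k+1) this gives
-- k μ(k m + r, m) ≤ q^m q^(k m + r). For the m-th summand T = q^m μ(n − 2m, m) and
-- k = ⌊(n − 2m)/m⌋ it follows that T q^m ≤ q^n and T k ≤ q^n, and as n ≤ (k + 3) m,
-- T n ≤ 4 m q^n. With L = ⌈log₂ n⌉, the summands m ≤ L contribute at most 4 L² q^n / n,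
-- and the later ones at most q^(n−m) ≤ 2^(L−m) q^n / n, a geometric tail below q^n / n.
-- Hence n · LHS ≤ 5 L² q^n, and squaring with L² ≤ 4 n gives the claim with c = 100.

open import Defs
open import Data.Nat using (ℕ; zero; suc; _+_; _*_; _∸_; _^_; _≤_; _<_; _⊔_; z≤n; s≤s; _≤?_; _/_; _%_; ⌊_/2⌋; ⌈_/2⌉; NonZero; >-nonZero; _≤′_; ≤′-refl; ≤′-step)
open import Data.Nat.Properties hiding (_≟_)
open import Data.Nat.Induction using (<-wellFounded)
open import Data.Nat.Logarithm using (⌈log₂_⌉; ⌈log₂⌉-mono-≤; ⌈log₂⌈n/2⌉⌉≡⌈log₂n⌉∸1; ⌈log₂2^n⌉≡n)
open import Data.Nat.DivMod using (m≡m%n+[m/n]*n; m%n<n)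
open import Data.Nat.Tactic.RingSolver using (solve-∀)
open import Data.Fin.Properties using (_≟_)
open import Data.List.Base using (List; []; _∷_; _++_; map; concatMap; length; filter; allFin; cartesianProductWith)
open import Data.List.Properties using (length-++; length-filter; filter-++; filter-none; filter-notAll; length-map; length-tabulate; map-++; map-∘; map-cong; map-id; ++-identityʳ; foldr-preservesᵇ; cartesianProductWith-distribʳ-++)
open import Data.List.Membership.Propositional using (_∈_)
open import Data.List.Relation.Unary.All as All using (All)
open import Data.List.Relation.Unary.All.Properties using (map⁺)
open import Data.List.Relation.Unary.Any as Any using ()
open import Data.List.Relation.Binary.Pointwise as Pointwise using ()
open import Data.List.Relation.Binary.Infix.Heterogeneous using (_++ⁱ_; _ⁱ++_)
open import Data.List.Relation.Binary.Infix.Heterogeneous.Properties using (infix?; fromPointwise)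
open import Data.Product using (_×_; _,_; proj₁; proj₂; ∃-syntax)
open import Induction.WellFounded using (Acc; acc)
open import Function using (_∘_; id)
open import Level using (Level)
open import Relation.Binary.PropositionalEquality
open import Relation.Nullary using (¬_; ¬?; yes; no; contradiction)
open import Relation.Unary using (Pred; Decidable)

private
  variable
    a b c d e f′ p r s : Level
    A : Set a
    B : Set b
    C : Set c
    D : Set d
    E : Set e
    F : Set f′

count : {P : Pred A p} → Decidable P → List A → ℕ
count P? = length ∘ filter P?

module _ {P : Pred A p} (P? : Decidable P) where

  count-++ : ∀ xs ys → count P? (xs ++ ys) ≡ count P? xs + count P? ys
  count-++ xs ys = trans (cong length (filter-++ P? xs ys)) (length-++ (filter P? xs))

  count-none : ∀ {xs} → All (¬_ ∘ P) xs → count P? xs ≡ 0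
  count-none = cong length ∘ filter-none P?

module _ {P : Pred A p} {Q : Pred B r} (P? : Decidable P) (Q? : Decidable Q) {f : B → A} where

  count-map-≤ : (∀ {y} → P (f y) → Q y) → ∀ ys → count P? (map f ys) ≤ count Q? ys
  count-map-≤ P⇒Q []       = z≤n
  count-map-≤ P⇒Q (y ∷ ys) with P? (f y) | Q? y
  ... | yes _   | yes _   = s≤s (count-map-≤ P⇒Q ys)
  ... | yes Pfy | no ¬Qy  = contradiction (P⇒Q Pfy) ¬Qy
  ... | no  _   | yes _   = m≤n⇒m≤1+n (count-map-≤ P⇒Q ys)
  ... | no  _   | no  _   = count-map-≤ P⇒Q ys

module _ {P : Pred A p} {Q : Pred B r} {R : Pred C s} (P? : Decidable P) (Q? : Decidable Q) (R? : Decidable R)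
         {f : A → B → C} (split : ∀ {x y} → R (f x y) → P x × Q y) where

  count-cartesianProductWith-≤ : ∀ xs ys →
    count R? (cartesianProductWith f xs ys) ≤ count P? xs * count Q? ys
  count-cartesianProductWith-≤ []       ys = z≤n
  count-cartesianProductWith-≤ (x ∷ xs) ys
    rewrite count-++ R? (map (f x) ys) (cartesianProductWith f xs ys) with P? x
  ... | yes _  = +-mono-≤ (count-map-≤ R? Q? (proj₂ ∘ split) ys) (count-cartesianProductWith-≤ xs ys)
  ... | no ¬Px = begin
    count R? (map (f x) ys) + count R? (cartesianProductWith f xs ys)
      ≡⟨ cong (_+ _) (count-none R? (map⁺ (All.universal (λ _ → ¬Px ∘ proj₁ ∘ split) ys))) ⟩
    count R? (cartesianProductWith f xs ys)
      ≤⟨ count-cartesianProductWith-≤ xs ys ⟩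
    count P? xs * count Q? ys ∎
    where open ≤-Reasoning

length-cartesianProductWith : (f : A → B → C) → ∀ xs ys →
  length (cartesianProductWith f xs ys) ≡ length xs * length ys
length-cartesianProductWith f []       ys = refl
length-cartesianProductWith f (x ∷ xs) ys = begin
  length (map (f x) ys ++ cartesianProductWith f xs ys)       ≡⟨ length-++ (map (f x) ys) ⟩
  length (map (f x) ys) + length (cartesianProductWith f xs ys) ≡⟨ cong₂ _+_ (length-map (f x) ys) (length-cartesianProductWith f xs ys) ⟩
  length ys + length xs * length ys                           ∎
  where open ≡-Reasoning

concatMap-map≡cartesianProductWith : (f : A → B → C) → ∀ xs ys →
  concatMap (λ x → map (f x) ys) xs ≡ cartesianProductWith f xs ys
concatMap-map≡cartesianProductWith f []       ys = refl
concatMap-map≡cartesianProductWith f (x ∷ xs) ys =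
  cong (map (f x) ys ++_) (concatMap-map≡cartesianProductWith f xs ys)

map-cartesianProductWith : (g : C → D) (f : A → B → C) → ∀ xs ys →
  map g (cartesianProductWith f xs ys) ≡ cartesianProductWith (λ x y → g (f x y)) xs ys
map-cartesianProductWith g f []       ys = refl
map-cartesianProductWith g f (x ∷ xs) ys = begin
  map g (map (f x) ys ++ cartesianProductWith f xs ys)       ≡⟨ map-++ g (map (f x) ys) _ ⟩
  map g (map (f x) ys) ++ map g (cartesianProductWith f xs ys) ≡⟨ cong₂ _++_ (sym (map-∘ ys)) (map-cartesianProductWith g f xs ys) ⟩
  map (g ∘ f x) ys ++ cartesianProductWith (λ x y → g (f x y)) xs ys ∎
  where open ≡-Reasoning

cartesianProductWith-mapˡ : (f : B → C → D) (g : A → B) → ∀ xs ys →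
  cartesianProductWith f (map g xs) ys ≡ cartesianProductWith (f ∘ g) xs ys
cartesianProductWith-mapˡ f g []       ys = refl
cartesianProductWith-mapˡ f g (x ∷ xs) ys = cong (map (f (g x)) ys ++_) (cartesianProductWith-mapˡ f g xs ys)

cartesianProductWith-cong : {f g : A → B → C} → (∀ x y → f x y ≡ g x y) → ∀ xs ys →
  cartesianProductWith f xs ys ≡ cartesianProductWith g xs ys
cartesianProductWith-cong f≗g []       ys = refl
cartesianProductWith-cong f≗g (x ∷ xs) ys = cong₂ _++_ (map-cong (f≗g x) ys) (cartesianProductWith-cong f≗g xs ys)

cartesianProductWith-assoc : (f : A → D → E) (g : B → C → D) (h : F → C → E) (k : A → B → F) →
  (∀ x y z → f x (g y z) ≡ h (k x y) z) → ∀ xs ys zs →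
  cartesianProductWith f xs (cartesianProductWith g ys zs) ≡
  cartesianProductWith h (cartesianProductWith k xs ys) zs
cartesianProductWith-assoc f g h k assoc []       ys zs = refl
cartesianProductWith-assoc f g h k assoc (x ∷ xs) ys zs = begin
  map (f x) (cartesianProductWith g ys zs) ++ cartesianProductWith f xs (cartesianProductWith g ys zs)
    ≡⟨ cong₂ _++_ (map-cartesianProductWith (f x) g ys zs) (cartesianProductWith-assoc f g h k assoc xs ys zs) ⟩
  cartesianProductWith (λ y z → f x (g y z)) ys zs ++ cartesianProductWith h (cartesianProductWith k xs ys) zs
    ≡⟨ cong (_++ _) (trans (cartesianProductWith-cong (assoc x) ys zs) (sym (cartesianProductWith-mapˡ h (k x) ys zs))) ⟩
  cartesianProductWith h (map (k x) ys) zs ++ cartesianProductWith h (cartesianProductWith k xs ys) zs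
    ≡⟨ sym (cartesianProductWith-distribʳ-++ h (map (k x) ys) _ zs) ⟩
  cartesianProductWith h (map (k x) ys ++ cartesianProductWith k xs ys) zs ∎
  where open ≡-Reasoning

allWords-suc : ∀ q ℓ → allWords q (suc ℓ) ≡ cartesianProductWith _∷_ (allFin q) (allWords q ℓ)
allWords-suc q ℓ = concatMap-map≡cartesianProductWith _∷_ (allFin q) (allWords q ℓ)

length-allWords : ∀ q ℓ → length (allWords q ℓ) ≡ q ^ ℓ
length-allWords q zero    = refl
length-allWords q (suc ℓ) = begin
  length (allWords q (suc ℓ))                                   ≡⟨ cong length (allWords-suc q ℓ) ⟩
  length (cartesianProductWith _∷_ (allFin q) (allWords q ℓ))   ≡⟨ length-cartesianProductWith _∷_ (allFin q) (allWords q ℓ) ⟩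
  length (allFin q) * length (allWords q ℓ)                     ≡⟨ cong₂ _*_ (length-tabulate {n = q} id) (length-allWords q ℓ) ⟩
  q * q ^ ℓ                                                     ∎
  where open ≡-Reasoning

allWords-+ : ∀ q m n → allWords q (m + n) ≡ cartesianProductWith _++_ (allWords q m) (allWords q n)
allWords-+ q zero    n = sym (trans (++-identityʳ _) (map-id (allWords q n)))
allWords-+ q (suc m) n = begin
  allWords q (suc m + n)
    ≡⟨ allWords-suc q (m + n) ⟩
  cartesianProductWith _∷_ (allFin q) (allWords q (m + n))
    ≡⟨ cong (cartesianProductWith _∷_ (allFin q)) (allWords-+ q m n) ⟩
  cartesianProductWith _∷_ (allFin q) (cartesianProductWith _++_ (allWords q m) (allWords q n))
    ≡⟨ cartesianProductWith-assoc _∷_ _++_ _++_ _∷_ (λ _ _ _ → refl) (allFin q) (allWords q m) (allWords q n) ⟩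
  cartesianProductWith _++_ (cartesianProductWith _∷_ (allFin q) (allWords q m)) (allWords q n)
    ≡⟨ cong (λ W → cartesianProductWith _++_ W (allWords q n)) (allWords-suc q m) ⟨
  cartesianProductWith _++_ (allWords q (suc m)) (allWords q n) ∎
  where open ≡-Reasoning

n*m^n≤[1+m]^[1+n] : ∀ m n → n * m ^ n ≤ suc m ^ suc n
n*m^n≤[1+m]^[1+n] m zero    = z≤n
n*m^n≤[1+m]^[1+n] m (suc n) = begin
  suc n * (m * m ^ n)             ≡⟨ rearrange m (m ^ n) n ⟩
  m * m ^ n + m * (n * m ^ n)     ≤⟨ +-mono-≤ (^-monoˡ-≤ (suc n) (n≤1+n m)) (*-monoʳ-≤ m (n*m^n≤[1+m]^[1+n] m n)) ⟩
  suc m ^ suc n + m * suc m ^ suc n ∎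
  where
  open ≤-Reasoning
  rearrange : ∀ m x n → suc n * (m * x) ≡ m * x + m * (n * x)
  rearrange = solve-∀

module _ {q : ℕ} (w : Word q) where

  private
    avoids? : Decidable (λ (u : Word q) → ¬ IsFactor w u)
    avoids? u = ¬? (infix? _≟_ w u)

  avoidCount-+ : ∀ m n → avoidCount q w (m + n) ≤ avoidCount q w m * avoidCount q w n
  avoidCount-+ m n rewrite allWords-+ q m n =
    count-cartesianProductWith-≤ avoids? avoids? avoids?
      (λ {u} {v} w⋢uv → (w⋢uv ∘ (_ⁱ++ v)) , (w⋢uv ∘ (u ++ⁱ_)))
      (allWords q m) (allWords q n)

  avoidCount-≤ : ∀ ℓ → avoidCount q w ℓ ≤ q ^ ℓ
  avoidCount-≤ ℓ = ≤-trans (length-filter avoids? (allWords q ℓ)) (≤-reflexive (length-allWords q ℓ))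

  avoidCount-< : ∀ m → w ∈ allWords q m → avoidCount q w m < q ^ m
  avoidCount-< m w∈Σᵐ = subst (avoidCount q w m <_) (length-allWords q m)
    (filter-notAll avoids? (allWords q m) (Any.map (λ { refl w⋢w → w⋢w w⊑w }) w∈Σᵐ))
    where
    w⊑w : IsFactor w w
    w⊑w = fromPointwise (Pointwise.refl refl)

  avoidCount-blocks : ∀ m k r → avoidCount q w (k * m + r) ≤ avoidCount q w m ^ k * q ^ r
  avoidCount-blocks m zero    r = ≤-trans (avoidCount-≤ r) (≤-reflexive (sym (*-identityˡ (q ^ r))))
  avoidCount-blocks m (suc k) r = begin
    avoidCount q w (m + k * m + r)                          ≡⟨ cong (avoidCount q w) (+-assoc m (k * m) r) ⟩
    avoidCount q w (m + (k * m + r))                        ≤⟨ avoidCount-+ m (k * m + r) ⟩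
    avoidCount q w m * avoidCount q w (k * m + r)           ≤⟨ *-monoʳ-≤ (avoidCount q w m) (avoidCount-blocks m k r) ⟩
    avoidCount q w m * (avoidCount q w m ^ k * q ^ r)       ≡⟨ *-assoc (avoidCount q w m) _ (q ^ r) ⟨
    avoidCount q w m ^ suc k * q ^ r                        ∎
    where open ≤-Reasoning

  *-avoidCount-blocks : ∀ {m} → w ∈ allWords q m → ∀ k r →
    k * avoidCount q w (k * m + r) ≤ q ^ m * q ^ (k * m + r)
  *-avoidCount-blocks {m} w∈Σᵐ k r = begin
    k * avoidCount q w (k * m + r)   ≤⟨ *-monoʳ-≤ k (avoidCount-blocks m k r) ⟩
    k * (x ^ k * q ^ r)              ≡⟨ *-assoc k (x ^ k) (q ^ r) ⟨
    k * x ^ k * q ^ r                ≤⟨ *-monoˡ-≤ (q ^ r) (n*m^n≤[1+m]^[1+n] x k) ⟩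
    suc x ^ suc k * q ^ r            ≤⟨ *-monoˡ-≤ (q ^ r) (^-monoˡ-≤ (suc k) (avoidCount-< m w∈Σᵐ)) ⟩
    (q ^ m) ^ suc k * q ^ r          ≡⟨ *-assoc (q ^ m) ((q ^ m) ^ k) (q ^ r) ⟩
    q ^ m * ((q ^ m) ^ k * q ^ r)    ≡⟨ cong (q ^ m *_) q^[km+r] ⟨
    q ^ m * q ^ (k * m + r)          ∎
    where
    open ≤-Reasoning
    x : ℕ
    x = avoidCount q w m
    q^[km+r] : q ^ (k * m + r) ≡ (q ^ m) ^ k * q ^ r
    q^[km+r] = begin-equality
      q ^ (k * m + r)       ≡⟨ ^-distribˡ-+-* q (k * m) r ⟩
      q ^ (k * m) * q ^ r   ≡⟨ cong (λ e → q ^ e * q ^ r) (*-comm k m) ⟩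
      q ^ (m * k) * q ^ r   ≡⟨ cong (_* q ^ r) (^-*-assoc q m k) ⟨
      (q ^ m) ^ k * q ^ r   ∎

μ-preserves : ∀ {p} (P : ℕ → Set p) → (∀ {x y} → P x → P y → P (x ⊔ y)) → P 0 →
  ∀ q ℓ m → (∀ {w} → w ∈ allWords q m → P (avoidCount q w ℓ)) → P (μ q ℓ m)
μ-preserves P ⊔-pres P0 q ℓ m Pavoid =
  foldr-preservesᵇ {P = P} ⊔-pres P0 (map⁺ {f = λ w → avoidCount q w ℓ} (All.tabulate Pavoid))

μ-≤ : ∀ q ℓ m → μ q ℓ m ≤ q ^ ℓ
μ-≤ q ℓ m = μ-preserves (_≤ q ^ ℓ) ⊔-lub z≤n q ℓ m (λ {w} _ → avoidCount-≤ w ℓ)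

*-μ-blocks : ∀ q m k r → k * μ q (k * m + r) m ≤ q ^ m * q ^ (k * m + r)
*-μ-blocks q m k r =
  μ-preserves (λ x → k * x ≤ q ^ m * q ^ (k * m + r))
    (λ {x} {y} kx≤ ky≤ → ≤-trans (≤-reflexive (*-distribˡ-⊔ k x y)) (⊔-lub kx≤ ky≤))
    (≤-trans (≤-reflexive (*-zeroʳ k)) z≤n) q (k * m + r) m
    (λ {w} w∈Σᵐ → *-avoidCount-blocks w w∈Σᵐ k r)

[ℓ/m]*μ-≤ : ∀ q ℓ m .{{_ : NonZero m}} → (ℓ / m) * μ q ℓ m ≤ q ^ m * q ^ ℓ
[ℓ/m]*μ-≤ q ℓ m = subst (λ x → (ℓ / m) * μ q x m ≤ q ^ m * q ^ x) (sym ℓ≡km+r) (*-μ-blocks q m (ℓ / m) (ℓ % m))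
  where
  ℓ≡km+r : ℓ ≡ ℓ / m * m + ℓ % m
  ℓ≡km+r = trans (m≡m%n+[m/n]*n ℓ m) (+-comm (ℓ % m) _)

q^n≡q^m*q^m*q^[n∸2m] : ∀ q {m n} → 2 * m ≤ n → q ^ n ≡ q ^ m * (q ^ m * q ^ (n ∸ 2 * m))
q^n≡q^m*q^m*q^[n∸2m] q {m} {n} 2m≤n = begin
  q ^ n                               ≡⟨ cong (q ^_) (m+[n∸m]≡n 2m≤n) ⟨
  q ^ (2 * m + ℓ)                     ≡⟨ cong (q ^_) (rearrange m ℓ) ⟩
  q ^ (m + (m + ℓ))                   ≡⟨ ^-distribˡ-+-* q m (m + ℓ) ⟩
  q ^ m * q ^ (m + ℓ)                 ≡⟨ cong (q ^ m *_) (^-distribˡ-+-* q m ℓ) ⟩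
  q ^ m * (q ^ m * q ^ ℓ)             ∎
  where
  open ≡-Reasoning
  ℓ : ℕ
  ℓ = n ∸ 2 * m
  rearrange : ∀ m ℓ → 2 * m + ℓ ≡ m + (m + ℓ)
  rearrange = solve-∀

term-*-≤ : ∀ q n m c → (2 * m ≤ n → c * μ q (n ∸ 2 * m) m ≤ q ^ m * q ^ (n ∸ 2 * m)) →
  term q n m * c ≤ q ^ n
term-*-≤ q n m c cμ≤ with 2 * m ≤? n
... | no  _    = z≤n
... | yes 2m≤n = begin
  q ^ m * μ q ℓ m * c           ≡⟨ rearrange (q ^ m) (μ q ℓ m) c ⟩
  q ^ m * (c * μ q ℓ m)         ≤⟨ *-monoʳ-≤ (q ^ m) (cμ≤ 2m≤n) ⟩
  q ^ m * (q ^ m * q ^ ℓ)       ≡⟨ q^n≡q^m*q^m*q^[n∸2m] q {m} 2m≤n ⟨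
  q ^ n                         ∎
  where
  open ≤-Reasoning
  ℓ : ℕ
  ℓ = n ∸ 2 * m
  rearrange : ∀ Q x c → Q * x * c ≡ Q * (c * x)
  rearrange = solve-∀

term-*q^m-≤ : ∀ q n m → term q n m * q ^ m ≤ q ^ n
term-*q^m-≤ q n m = term-*-≤ q n m (q ^ m) (λ _ → *-monoʳ-≤ (q ^ m) (μ-≤ q (n ∸ 2 * m) m))

term-≤ : ∀ q n m .{{_ : NonZero q}} → term q n m ≤ q ^ n
term-≤ q n m = ≤-trans (m≤m*n (term q n m) (q ^ m) {{m^n≢0 q m}}) (term-*q^m-≤ q n m)

m<[1+m/n]*n : ∀ m n .{{_ : NonZero n}} → m < suc (m / n) * n
m<[1+m/n]*n m n = begin-strict
  m                   ≡⟨ m≡m%n+[m/n]*n m n ⟩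
  m % n + m / n * n   <⟨ +-monoˡ-< (m / n * n) (m%n<n m n) ⟩
  n + m / n * n       ∎
  where open ≤-Reasoning

term-*n-≤ : ∀ q n m .{{_ : NonZero q}} .{{_ : NonZero m}} → term q n m * n ≤ 4 * m * q ^ n
term-*n-≤ q n m = begin
  T * n                        ≤⟨ *-monoʳ-≤ T n≤[3+k]*m ⟩
  T * ((3 + k) * m)            ≡⟨ rearrange T k m ⟩
  (3 * T + T * k) * m          ≤⟨ *-monoˡ-≤ m (+-mono-≤ (*-monoʳ-≤ 3 (term-≤ q n m)) T*k≤) ⟩
  (3 * q ^ n + q ^ n) * m      ≡⟨ rearrange′ (q ^ n) m ⟩
  4 * m * q ^ n                ∎
  where
  open ≤-Reasoning
  T k : ℕ
  T = term q n m
  k = (n ∸ 2 * m) / m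
  rearrange : ∀ T k m → T * ((3 + k) * m) ≡ (3 * T + T * k) * m
  rearrange = solve-∀
  rearrange′ : ∀ N m → (3 * N + N) * m ≡ 4 * m * N
  rearrange′ = solve-∀
  rearrange″ : ∀ k m → 2 * m + suc k * m ≡ (3 + k) * m
  rearrange″ = solve-∀
  T*k≤ : T * k ≤ q ^ n
  T*k≤ = term-*-≤ q n m k (λ _ → [ℓ/m]*μ-≤ q (n ∸ 2 * m) m)
  n≤[3+k]*m : n ≤ (3 + k) * m
  n≤[3+k]*m = begin
    n                        ≤⟨ m≤n+m∸n n (2 * m) ⟩
    2 * m + (n ∸ 2 * m)      ≤⟨ +-monoʳ-≤ (2 * m) (<⇒≤ (m<[1+m/n]*n (n ∸ 2 * m) m)) ⟩
    2 * m + suc k * m        ≡⟨ rearrange″ k m ⟩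
    (3 + k) * m              ∎

n≤2*⌈n/2⌉ : ∀ n → n ≤ 2 * ⌈ n /2⌉
n≤2*⌈n/2⌉ n = begin
  n                        ≡⟨ ⌊n/2⌋+⌈n/2⌉≡n n ⟨
  ⌊ n /2⌋ + ⌈ n /2⌉         ≤⟨ +-monoˡ-≤ ⌈ n /2⌉ (⌊n/2⌋≤⌈n/2⌉ n) ⟩
  ⌈ n /2⌉ + ⌈ n /2⌉         ≡⟨ cong (⌈ n /2⌉ +_) (+-identityʳ ⌈ n /2⌉) ⟨
  2 * ⌈ n /2⌉               ∎
  where open ≤-Reasoning

2*⌊n/2⌋≤n : ∀ n → 2 * ⌊ n /2⌋ ≤ n
2*⌊n/2⌋≤n n = begin
  2 * ⌊ n /2⌋               ≡⟨ cong (⌊ n /2⌋ +_) (+-identityʳ ⌊ n /2⌋) ⟩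
  ⌊ n /2⌋ + ⌊ n /2⌋         ≤⟨ +-monoʳ-≤ ⌊ n /2⌋ (⌊n/2⌋≤⌈n/2⌉ n) ⟩
  ⌊ n /2⌋ + ⌈ n /2⌉         ≡⟨ ⌊n/2⌋+⌈n/2⌉≡n n ⟩
  n                        ∎
  where open ≤-Reasoning

⌈log₂n⌉>0 : ∀ {n} → 1 < n → 0 < ⌈log₂ n ⌉
⌈log₂n⌉>0 1<n = ≤-trans (≤-reflexive (sym (⌈log₂2^n⌉≡n 1))) (⌈log₂⌉-mono-≤ 1<n)

2^⌈log₂n⌉≡2*2^⌈log₂⌈n/2⌉⌉ : ∀ n → 1 < n → 2 ^ ⌈log₂ n ⌉ ≡ 2 * 2 ^ ⌈log₂ ⌈ n /2⌉ ⌉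
2^⌈log₂n⌉≡2*2^⌈log₂⌈n/2⌉⌉ n 1<n = begin
  2 ^ ⌈log₂ n ⌉                 ≡⟨ cong (2 ^_) (suc-pred ⌈log₂ n ⌉ {{>-nonZero (⌈log₂n⌉>0 1<n)}}) ⟨
  2 ^ suc (⌈log₂ n ⌉ ∸ 1)       ≡⟨ cong ((2 *_) ∘ (2 ^_)) (⌈log₂⌈n/2⌉⌉≡⌈log₂n⌉∸1 n) ⟨
  2 * 2 ^ ⌈log₂ ⌈ n /2⌉ ⌉       ∎
  where open ≡-Reasoning

n≤2^⌈log₂n⌉ : ∀ n → n ≤ 2 ^ ⌈log₂ n ⌉
n≤2^⌈log₂n⌉ n = go n (<-wellFounded n)
  where
  go : ∀ n → Acc _<_ n → n ≤ 2 ^ ⌈log₂ n ⌉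
  go 0 _ = z≤n
  go 1 _ = ≤-refl
  go n@(suc (suc k)) (acc rec) = begin
    n                             ≤⟨ n≤2*⌈n/2⌉ n ⟩
    2 * ⌈ n /2⌉                   ≤⟨ *-monoʳ-≤ 2 (go ⌈ n /2⌉ (rec (⌈n/2⌉<n k))) ⟩
    2 * 2 ^ ⌈log₂ ⌈ n /2⌉ ⌉       ≡⟨ 2^⌈log₂n⌉≡2*2^⌈log₂⌈n/2⌉⌉ n (s≤s (s≤s z≤n)) ⟨
    2 ^ ⌈log₂ n ⌉                 ∎
    where open ≤-Reasoning

-- That is, 2^(⌈log₂ n⌉ − 1) < n, in a form that survives the recursion through ⌈ n /2⌉.
2^⌈log₂n⌉+2≤2n : ∀ {n} → 1 < n → 2 ^ ⌈log₂ n ⌉ + 2 ≤ 2 * n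
2^⌈log₂n⌉+2≤2n {n} 1<n = go n (<-wellFounded n) 1<n
  where
  go : ∀ n → Acc _<_ n → 1 < n → 2 ^ ⌈log₂ n ⌉ + 2 ≤ 2 * n
  go 1 _ (s≤s ())
  go 2 _ _ = ≤-refl
  go n@(suc (suc (suc k))) (acc rec) _ = +-cancelʳ-≤ 2 _ _ (begin
    (2 ^ ⌈log₂ n ⌉ + 2) + 2       ≡⟨ cong (λ x → x + 2 + 2) (2^⌈log₂n⌉≡2*2^⌈log₂⌈n/2⌉⌉ n (s≤s (s≤s z≤n))) ⟩
    (2 * x + 2) + 2               ≡⟨ rearrange x ⟩
    2 * (x + 2)                   ≤⟨ *-monoʳ-≤ 2 (go h (rec (⌈n/2⌉<n (suc k))) (s≤s (s≤s z≤n))) ⟩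
    2 * (2 * h)                   ≤⟨ *-monoʳ-≤ 2 (2*⌊n/2⌋≤n (suc n)) ⟩
    2 * suc n                     ≡⟨ trans (*-suc 2 n) (+-comm 2 (2 * n)) ⟩
    2 * n + 2                     ∎)
    where
    open ≤-Reasoning
    h x : ℕ
    h = ⌈ n /2⌉
    x = 2 ^ ⌈log₂ h ⌉
    rearrange : ∀ x → (2 * x + 2) + 2 ≡ 2 * (x + 2)
    rearrange = solve-∀

2*n+1≤2^[1+n] : ∀ n → 2 * n + 1 ≤ 2 ^ suc n
2*n+1≤2^[1+n] zero    = s≤s z≤n
2*n+1≤2^[1+n] (suc n) = begin
  2 * suc n + 1             ≡⟨ rearrange n ⟩
  (2 * n + 1) + 2 * 1       ≤⟨ +-mono-≤ (2*n+1≤2^[1+n] n) (*-monoʳ-≤ 2 (m^n>0 2 n)) ⟩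
  2 ^ suc n + 2 * 2 ^ n     ≡⟨ cong (2 ^ suc n +_) (+-identityʳ (2 ^ suc n)) ⟨
  2 ^ suc (suc n)           ∎
  where
  open ≤-Reasoning
  rearrange : ∀ n → 2 * suc n + 1 ≡ (2 * n + 1) + 2 * 1
  rearrange = solve-∀

n*n≤2^[1+n] : ∀ n → n * n ≤ 2 ^ suc n
n*n≤2^[1+n] zero    = z≤n
n*n≤2^[1+n] (suc n) = begin
  suc n * suc n             ≡⟨ rearrange n ⟩
  n * n + (2 * n + 1)       ≤⟨ +-mono-≤ (n*n≤2^[1+n] n) (2*n+1≤2^[1+n] n) ⟩
  2 ^ suc n + 2 ^ suc n     ≡⟨ cong (2 ^ suc n +_) (+-identityʳ (2 ^ suc n)) ⟨
  2 ^ suc (suc n)           ∎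
  where
  open ≤-Reasoning
  rearrange : ∀ n → suc n * suc n ≡ n * n + (2 * n + 1)
  rearrange = solve-∀

⌈log₂n⌉²≤4n : ∀ {n} → 1 < n → ⌈log₂ n ⌉ * ⌈log₂ n ⌉ ≤ 4 * n
⌈log₂n⌉²≤4n {n} 1<n = begin
  ⌈log₂ n ⌉ * ⌈log₂ n ⌉     ≤⟨ n*n≤2^[1+n] ⌈log₂ n ⌉ ⟩
  2 * 2 ^ ⌈log₂ n ⌉         ≤⟨ *-monoʳ-≤ 2 (m+n≤o⇒m≤o (2 ^ ⌈log₂ n ⌉) (2^⌈log₂n⌉+2≤2n 1<n)) ⟩
  2 * (2 * n)               ≡⟨ *-assoc 2 2 n ⟨
  4 * n                     ∎
  where open ≤-Reasoning

sumFrom1-mono-≤ : ∀ f {K K′} → K ≤ K′ → sumFrom1 K f ≤ sumFrom1 K′ f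
sumFrom1-mono-≤ f K≤K′ = go (≤⇒≤′ K≤K′)
  where
  go : ∀ {K K′} → K ≤′ K′ → sumFrom1 K f ≤ sumFrom1 K′ f
  go ≤′-refl       = ≤-refl
  go (≤′-step K≤K′) = ≤-trans (go K≤K′) (m≤m+n _ _)

sumFrom1-+ : ∀ f L K → sumFrom1 (L + K) f ≡ sumFrom1 L f + sumFrom1 K (λ j → f (L + j))
sumFrom1-+ f L zero    = trans (cong (λ K → sumFrom1 K f) (+-identityʳ L)) (sym (+-identityʳ _))
sumFrom1-+ f L (suc K) = begin
  sumFrom1 (L + suc K) f                                          ≡⟨ cong (λ K → sumFrom1 K f) (+-suc L K) ⟩
  sumFrom1 (L + K) f + f (suc (L + K))                            ≡⟨ cong₂ _+_ (sumFrom1-+ f L K) (cong f (sym (+-suc L K))) ⟩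
  sumFrom1 L f + sumFrom1 K (λ j → f (L + j)) + f (L + suc K)     ≡⟨ +-assoc (sumFrom1 L f) _ _ ⟩
  sumFrom1 L f + sumFrom1 (suc K) (λ j → f (L + j))               ∎
  where open ≡-Reasoning

*-distribʳ-sumFrom1 : ∀ c f K → sumFrom1 K f * c ≡ sumFrom1 K (λ m → f m * c)
*-distribʳ-sumFrom1 c f zero    = refl
*-distribʳ-sumFrom1 c f (suc K) =
  trans (*-distribʳ-+ c (sumFrom1 K f) (f (suc K))) (cong (_+ f (suc K) * c) (*-distribʳ-sumFrom1 c f K))

sumFrom1-≤-* : ∀ f K B → (∀ m → 1 ≤ m → m ≤ K → f m ≤ B) → sumFrom1 K f ≤ K * B
sumFrom1-≤-* f zero    B f≤B = z≤n
sumFrom1-≤-* f (suc K) B f≤B = begin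
  sumFrom1 K f + f (suc K)   ≤⟨ +-mono-≤ (sumFrom1-≤-* f K B (λ m 1≤m m≤K → f≤B m 1≤m (m≤n⇒m≤1+n m≤K))) (f≤B (suc K) (s≤s z≤n) ≤-refl) ⟩
  K * B + B                  ≡⟨ +-comm (K * B) B ⟩
  suc K * B                  ∎
  where open ≤-Reasoning

sumFrom1-≤-geometric : ∀ g A K → (∀ j → g (suc j) * 2 ^ suc j ≤ A) → sumFrom1 K g ≤ A
sumFrom1-≤-geometric g A K g≤ =
  *-cancelʳ-≤ (sumFrom1 K g) A (2 ^ K) {{m^n≢0 2 K}} (≤-trans (m≤m+n _ A) (go K))
  where
  go : ∀ K → sumFrom1 K g * 2 ^ K + A ≤ A * 2 ^ K
  go zero    = ≤-reflexive (sym (*-identityʳ A))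
  go (suc K) = begin
    (S + g (suc K)) * (2 * P) + A           ≡⟨ rearrange S (g (suc K)) P A ⟩
    2 * (S * P) + (g (suc K) * (2 * P) + A) ≤⟨ +-monoʳ-≤ (2 * (S * P)) (+-monoˡ-≤ A (g≤ K)) ⟩
    2 * (S * P) + (A + A)                   ≡⟨ rearrange′ S P A ⟩
    2 * (S * P + A)                         ≤⟨ *-monoʳ-≤ 2 (go K) ⟩
    2 * (A * P)                             ≡⟨ rearrange″ A P ⟩
    A * (2 * P)                             ∎
    where
    open ≤-Reasoning
    S P : ℕ
    S = sumFrom1 K g
    P = 2 ^ K
    rearrange : ∀ S G P A → (S + G) * (2 * P) + A ≡ 2 * (S * P) + (G * (2 * P) + A)
    rearrange = solve-∀
    rearrange′ : ∀ S P A → 2 * (S * P) + (A + A) ≡ 2 * (S * P + A)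
    rearrange′ = solve-∀
    rearrange″ : ∀ A P → 2 * (A * P) ≡ A * (2 * P)
    rearrange″ = solve-∀

term[L+j]*n*2^j≤q^n : ∀ q n j → 2 ≤ q → term q n (⌈log₂ n ⌉ + j) * n * 2 ^ j ≤ q ^ n
term[L+j]*n*2^j≤q^n q n j 2≤q = begin
  T * n * 2 ^ j           ≤⟨ *-monoˡ-≤ (2 ^ j) (*-monoʳ-≤ T (n≤2^⌈log₂n⌉ n)) ⟩
  T * 2 ^ L * 2 ^ j       ≡⟨ *-assoc T (2 ^ L) (2 ^ j) ⟩
  T * (2 ^ L * 2 ^ j)     ≡⟨ cong (T *_) (^-distribˡ-+-* 2 L j) ⟨
  T * 2 ^ (L + j)         ≤⟨ *-monoʳ-≤ T (^-monoˡ-≤ (L + j) 2≤q) ⟩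
  T * q ^ (L + j)         ≤⟨ term-*q^m-≤ q n (L + j) ⟩
  q ^ n                   ∎
  where
  open ≤-Reasoning
  L T : ℕ
  L = ⌈log₂ n ⌉
  T = term q n (L + j)

lhs*n≤5*⌈log₂n⌉²*q^n : ∀ q n → 1 < q → 1 < n → lhs q n * n ≤ 5 * (⌈log₂ n ⌉ * ⌈log₂ n ⌉) * q ^ n
lhs*n≤5*⌈log₂n⌉²*q^n q@(suc _) n 1<q 1<n = begin
  sumFrom1 K f * n                                     ≤⟨ *-monoˡ-≤ n (sumFrom1-mono-≤ f (m≤n+m K L)) ⟩
  sumFrom1 (L + K) f * n                               ≡⟨ cong (_* n) (sumFrom1-+ f L K) ⟩
  (sumFrom1 L f + sumFrom1 K g) * n                    ≡⟨ *-distribʳ-+ n (sumFrom1 L f) (sumFrom1 K g) ⟩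
  sumFrom1 L f * n + sumFrom1 K g * n                  ≡⟨ cong₂ _+_ (*-distribʳ-sumFrom1 n f L) (*-distribʳ-sumFrom1 n g K) ⟩
  sumFrom1 L (λ m → f m * n) + sumFrom1 K (λ j → g j * n)
    ≤⟨ +-mono-≤ (sumFrom1-≤-* (λ m → f m * n) L (4 * L * N) head≤) (sumFrom1-≤-geometric (λ j → g j * n) N K tail≤) ⟩
  L * (4 * L * N) + N                                  ≤⟨ +-monoʳ-≤ (L * (4 * L * N)) (m≤n*m N (L * L) {{L*L≢0}}) ⟩
  L * (4 * L * N) + L * L * N                          ≡⟨ rearrange L N ⟩
  5 * (L * L) * N                                      ∎
  where
  open ≤-Reasoning
  L K N : ℕ
  L = ⌈log₂ n ⌉
  K = (n + 1) / 2
  N = q ^ n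
  f g : ℕ → ℕ
  f = term q n
  g j = f (L + j)
  L*L≢0 : NonZero (L * L)
  L*L≢0 = m*n≢0 L L {{>-nonZero (⌈log₂n⌉>0 1<n)}} {{>-nonZero (⌈log₂n⌉>0 1<n)}}
  head≤ : ∀ m → 1 ≤ m → m ≤ L → f m * n ≤ 4 * L * N
  head≤ m@(suc _) _ m≤L = ≤-trans (term-*n-≤ q n m) (*-monoˡ-≤ N (*-monoʳ-≤ 4 m≤L))
  tail≤ : ∀ j → g (suc j) * n * 2 ^ suc j ≤ N
  tail≤ j = term[L+j]*n*2^j≤q^n q n (suc j) 1<q
  rearrange : ∀ L N → L * (4 * L * N) + L * L * N ≡ 5 * (L * L) * N
  rearrange = solve-∀

x*n≤5yz⇒x²n≤100yz² : ∀ {x y z n} → 0 < n → x * n ≤ 5 * y * z → y ≤ 4 * n → x * x * n ≤ 100 * y * (z * z)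
x*n≤5yz⇒x²n≤100yz² {x} {y} {z} {n} 0<n xn≤5yz y≤4n = *-cancelʳ-≤ _ _ n {{>-nonZero 0<n}} (begin
  x * x * n * n                  ≡⟨ rearrange x n ⟩
  (x * n) * (x * n)              ≤⟨ *-mono-≤ xn≤5yz xn≤5yz ⟩
  (5 * y * z) * (5 * y * z)      ≡⟨ rearrange′ y z ⟩
  25 * y * (y * (z * z))         ≤⟨ *-monoˡ-≤ (y * (z * z)) (*-monoʳ-≤ 25 y≤4n) ⟩
  25 * (4 * n) * (y * (z * z))   ≡⟨ rearrange″ n y z ⟩
  100 * y * (z * z) * n          ∎)
  where
  open ≤-Reasoning
  rearrange : ∀ x n → x * x * n * n ≡ (x * n) * (x * n)
  rearrange = solve-∀
  rearrange′ : ∀ y z → (5 * y * z) * (5 * y * z) ≡ 25 * y * (y * (z * z))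
  rearrange′ = solve-∀
  rearrange″ : ∀ n y z → 25 * (4 * n) * (y * (z * z)) ≡ 100 * y * (z * z) * n
  rearrange″ = solve-∀

proposition2 : (q : ℕ) → 1 < q →
    ∃[ c ] ((n : ℕ) → 1 < n →
      lhs q n * lhs q n * n ≤ c * (⌈log₂ n ⌉ * ⌈log₂ n ⌉) * (q ^ n * q ^ n))
proposition2 q 1<q = 100 , λ n 1<n →
  x*n≤5yz⇒x²n≤100yz² {lhs q n} (<⇒≤ 1<n) (lhs*n≤5*⌈log₂n⌉²*q^n q n 1<q 1<n) (⌈log₂n⌉²≤4n 1<n)
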